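{- Let $G$ be a finite simple graph with girth at least $7$ and let $k$ be an integer with $k\ge 2\chi(G)$. If $G$ has a $k$-iris, then $G$ has a b-coloring with $k$ colors.
   Context: All graphs are finite and simple; the girth of a graph is the minimum length of a cycle in it (infinite if the graph has no cycle). A (proper) $k$-coloring of $G$ is a map $\psi: V(G)\to\mathbb{N}$ with $|\psi(V(G))|=k$ and $\psi(u)\neq\psi(v)$ whenever $uv\in E(G)$; the sets $\psi^{ -1}(i)$ are the color classes. $\chi(G)$ is the chromatic number. Given a coloring $\psi$, a vertex $u$ is a b-vertex if $u$ has a neighbor in every color class other than $\psi^{ -1}(\psi(u))$. A b-coloring is a coloring in which every color class contains at least one b-vertex. For an integer $k$, a vertex $u\in V(G)$ is a $k$-iris if there exists $S\subseteq N(u)$ with $|S|\ge k-1$ and $d(v)\ge k-1$ for every $v\in S$ (where $d$ denotes degree in $G$). -}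

module Defs where

open import Data.Nat using (ℕ; zero; suc; _≤_; _<_; _∸_)
open import Data.Fin using (Fin; toℕ)
open import Data.Fin.Properties using ()
open import Data.List using (List; length; filter; allFin)
open import Data.List.Relation.Unary.All using (All)
open import Data.List.Relation.Unary.Unique.Propositional using (Unique)
open import Data.Product using (Σ; ∃; _×_; _,_)
open import Data.Sum using (_⊎_)
open import Relation.Nullary using (¬_; Dec)
open import Relation.Binary.PropositionalEquality using (_≡_; _≢_)
open import Function.Definitions using (Injective; Surjective)

record Graph : Set₁ where
  field
    n     : ℕ
    Adj   : Fin n → Fin n → Set
    adj?  : ∀ u v → Dec (Adj u v)
    sym   : ∀ {u v} → Adj u v → Adj v u
    irref : ∀ {u} → ¬ Adj u u

module _ (G : Graph) where
  open Graph G

  Vertex : Set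
  Vertex = Fin n

  deg : Vertex → ℕ
  deg v = length (filter (adj? v) (allFin n))

  record Cycle (l : ℕ) : Set where
    field
      len≥3 : 3 ≤ l
      f     : Fin l → Vertex
      inj   : Injective _≡_ _≡_ f
      adjs  : ∀ (i j : Fin l) →
              (toℕ j ≡ suc (toℕ i) ⊎ (toℕ i ≡ l ∸ 1 × toℕ j ≡ 0)) →
              Adj (f i) (f j)

  GirthAtLeast : ℕ → Set
  GirthAtLeast g = ∀ l → l < g → ¬ Cycle l

  -- a proper coloring with exactly k colors: a proper map onto Fin k
  -- (colors relabelled as 0, …, k-1; surjectivity = |ψ(V)| = k)
  record Coloring (k : ℕ) : Set where
    field
      ψ      : Vertex → Fin k
      proper : ∀ {u v} → Adj u v → ψ u ≢ ψ v
      onto   : Surjective _≡_ _≡_ ψ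

  IsChromaticNumber : ℕ → Set
  IsChromaticNumber c = Coloring c × (∀ m → Coloring m → c ≤ m)

  IsBVertex : ∀ {k} → Coloring k → Vertex → Set
  IsBVertex {k} C u =
    ∀ (c : Fin k) → c ≢ Coloring.ψ C u →
      ∃ λ v → Adj u v × Coloring.ψ C v ≡ c

  IsBColoring : ∀ {k} → Coloring k → Set
  IsBColoring {k} C = ∀ (c : Fin k) → ∃ λ u → Coloring.ψ C u ≡ c × IsBVertex C u

  HasBColoring : ℕ → Set
  HasBColoring k = Σ (Coloring k) IsBColoring

  IsIris : ℕ → Vertex → Set
  IsIris k u = ∃ λ (S : List Vertex) →
    Unique S × All (Adj u) S × (k ∸ 1 ≤ length S) × All (λ v → k ∸ 1 ≤ deg v) S

  HasIris : ℕ → Set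
  HasIris k = ∃ (IsIris k)

module Submission where

-- Let k = p + 2 and let u be a k-iris. Pick p + 1 neighbours v i of u and, below each
-- v i, p further neighbours w i a other than u. Colour u with 0, v i with i + 1 and the
-- w i a with the p colours in 1 … p + 1 other than i + 1; then u and every v i see all
-- other colours, so these k vertices are b-vertices, one per colour. Girth at least 7 makes
-- this tree induced and leaves every other vertex with at most one neighbour in it.
-- Those vertices take a χ(G)-colouring φ, read in the colours 0 … χ - 1, or shifted
-- to χ … 2χ - 1 when that clashes with the tree neighbour; as 2χ ≤ k this fits in k
-- colours and stays proper.

open import Defs
open import Data.Bool using (Bool; true; false)
open import Data.Empty using (⊥; ⊥-elim)
open import Data.Fin using (Fin; zero; suc; toℕ; fromℕ; inject≤; join; splitAt; punchIn; punchOut)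
  renaming (_≟_ to _≟ᶠ_)
open import Data.Fin.Properties
  using (toℕ-injective; toℕ-fromℕ; toℕ<n; inject≤-injective; splitAt-join; suc-injective;
         punchIn-injective; punchInᵢ≢i; punchIn-punchOut; any?)
open import Data.List using (List; []; _∷_; length; lookup; filter; allFin)
open import Data.List.Membership.Propositional.Properties using (∈-lookup)
open import Data.List.Relation.Unary.All as All using (All; []; _∷_)
open import Data.List.Relation.Unary.All.Properties using (all-filter)
open import Data.List.Relation.Unary.AllPairs using ([]; _∷_)
open import Data.List.Relation.Unary.Linked using (Linked; [-]; _∷_)
open import Data.List.Relation.Unary.Unique.Propositional using (Unique)
open import Data.List.Relation.Unary.Unique.Propositional.Properties using (filter⁺; allFin⁺)
open import Data.Maybe using (Maybe; just; nothing; fromMaybe)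
import Data.Maybe as Maybe
open import Data.Maybe.Properties using (just-injective) renaming (≡-dec to ≡-decᵐ)
open import Data.Nat using (ℕ; zero; suc; _+_; _*_; _≤_; _≤?_; z≤n; s≤s)
import Data.Nat.Properties as ℕ
open import Data.Product using (Σ; ∃; _×_; _,_; proj₁; proj₂)
open import Data.Sum using (_⊎_; inj₁; inj₂)
open import Function using (_∘_)
open import Function.Consequences.Propositional using (strictlySurjective⇒surjective)
open import Function.Definitions using (Injective)
open import Relation.Binary.Definitions using (DecidableEquality)
open import Relation.Binary.PropositionalEquality
  using (_≡_; _≢_; refl; sym; trans; cong; subst; module ≡-Reasoning)
open import Relation.Nullary using (¬_; Dec; yes; no; does)
open import Relation.Nullary.Decidable using (True; toWitness; dec⇒maybe; _×-dec_)

module _ {A : Set} where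

  lookup-injective : ∀ {xs : List A} → Unique xs → Injective _≡_ _≡_ (lookup xs)
  lookup-injective {_ ∷ _} _            {zero}  {zero}  _  = refl
  lookup-injective {_ ∷ _} (x∉xs ∷ _)   {zero}  {suc j} eq = ⊥-elim (All.lookup x∉xs (∈-lookup j) eq)
  lookup-injective {_ ∷ _} (x∉xs ∷ _)   {suc i} {zero}  eq =
    ⊥-elim (All.lookup x∉xs (∈-lookup i) (sym eq))
  lookup-injective {_ ∷ _} (_ ∷ unique) {suc i} {suc j} eq = cong suc (lookup-injective unique eq)

  Linked-lookup : ∀ {R : A → A → Set} {xs} → Linked R xs →
                  ∀ i j → toℕ j ≡ suc (toℕ i) → R (lookup xs i) (lookup xs j)
  Linked-lookup (r ∷ _)  zero    (suc zero)    refl = r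
  Linked-lookup (_ ∷ rs) (suc i) (suc j)       eq   = Linked-lookup rs i j (ℕ.suc-injective eq)
  Linked-lookup [-]      zero    zero          ()
  Linked-lookup (_ ∷ _)  zero    zero          ()
  Linked-lookup (_ ∷ _)  zero    (suc (suc _)) ()
  Linked-lookup (_ ∷ _)  (suc _) zero          ()

  choose : ∀ {P : A → Set} {m} {xs : List A} → Unique xs → All P xs → m ≤ length xs →
           Σ (Fin m → A) λ f → Injective _≡_ _≡_ f × (∀ i → P (f i))
  choose {m = m} {xs} unique all-P m≤|xs| = f , f-injective , λ i → All.lookup all-P (∈-lookup _)
    where
    f : Fin m → A
    f i = lookup xs (inject≤ i m≤|xs|)
    f-injective : Injective _≡_ _≡_ f
    f-injective eq = inject≤-injective _ _ _ _ (lookup-injective unique eq)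

  punchIn-avoiding : ∀ {m} → DecidableEquality A → (f : Fin (suc m) → A) →
                     Injective _≡_ _≡_ f → (x : A) → ∃ λ q → ∀ j → f (punchIn q j) ≢ x
  punchIn-avoiding _≟_ f f-injective x with any? (λ q → f q ≟ x)
  ... | yes (q , fq≡x) = q , λ j eq → punchInᵢ≢i q j (f-injective (trans eq (sym fq≡x)))
  ... | no  ∄q         = zero , λ j eq → ∄q (punchIn zero j , eq)

module _ (G : Graph) where
  open Graph G renaming (sym to Adj-sym)

  Adj⇒≢ : ∀ {x y} → Adj x y → x ≢ y
  Adj⇒≢ x~y refl = irref x~y

  cycle-of-closed-walk : ∀ x ys → 2 ≤ length ys → Unique (x ∷ ys) → Linked Adj (x ∷ ys) →
                         Adj (lookup (x ∷ ys) (fromℕ (length ys))) x → Cycle G (suc (length ys))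
  cycle-of-closed-walk x ys 2≤|ys| unique walk closing = record
    { len≥3 = s≤s 2≤|ys| ; f = lookup (x ∷ ys) ; inj = lookup-injective unique ; adjs = adjs }
    where
    adjs : ∀ i j → toℕ j ≡ suc (toℕ i) ⊎ (toℕ i ≡ length ys × toℕ j ≡ 0) →
           Adj (lookup (x ∷ ys) i) (lookup (x ∷ ys) j)
    adjs i j (inj₁ j≡1+i) = Linked-lookup walk i j j≡1+i
    adjs i j (inj₂ (i≡|ys| , j≡0))
      rewrite toℕ-injective (trans i≡|ys| (sym (toℕ-fromℕ (length ys))))
            | toℕ-injective {i = j} {j = zero} j≡0 = closing

  module Girth≥7 (girth : GirthAtLeast G 7) where

    no-short-closed-walk : ∀ x ys {_ : True (2 ≤? length ys)} {_ : True (length ys ≤? 5)} →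
                           Unique (x ∷ ys) → Linked Adj (x ∷ ys) →
                           ¬ Adj (lookup (x ∷ ys) (fromℕ (length ys))) x
    no-short-closed-walk x ys {2≤|ys|} {|ys|≤5} unique walk closing =
      girth _ (s≤s (s≤s (toWitness |ys|≤5)))
        (cycle-of-closed-walk x ys (toWitness 2≤|ys|) unique walk closing)

    no-triangle : ∀ {a b c} → Adj a b → Adj b c → ¬ Adj c a
    no-triangle {a} {b} {c} ab bc ca = no-short-closed-walk a (b ∷ c ∷ [])
      ((Adj⇒≢ ab ∷ Adj⇒≢ (Adj-sym ca) ∷ []) ∷ (Adj⇒≢ bc ∷ []) ∷ [] ∷ [])
      (ab ∷ bc ∷ [-]) ca

    no-closed-walk₄ : ∀ {a b c d} → Adj a b → Adj b c → Adj c d → Adj d a →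
                      a ≢ c → b ≢ d → ⊥
    no-closed-walk₄ {a} {b} {c} {d} ab bc cd da a≢c b≢d = no-short-closed-walk a (b ∷ c ∷ d ∷ [])
      ((Adj⇒≢ ab ∷ a≢c ∷ Adj⇒≢ (Adj-sym da) ∷ []) ∷ (Adj⇒≢ bc ∷ b≢d ∷ []) ∷
       (Adj⇒≢ cd ∷ []) ∷ [] ∷ [])
      (ab ∷ bc ∷ cd ∷ [-]) da

    -- A repeated vertex would split the walk into a triangle and a closed walk of length two.
    no-closed-walk₅ : ∀ {a b c d e} → Adj a b → Adj b c → Adj c d → Adj d e → ¬ Adj e a
    no-closed-walk₅ {a} {b} {c} {d} {e} ab bc cd de ea
      with a ≟ᶠ c | a ≟ᶠ d | b ≟ᶠ d | b ≟ᶠ e | c ≟ᶠ e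
    ... | yes refl | _        | _        | _        | _        = no-triangle cd de ea
    ... | no _     | yes refl | _        | _        | _        = no-triangle ab bc cd
    ... | no _     | no _     | yes refl | _        | _        = no-triangle de ea ab
    ... | no _     | no _     | no _     | yes refl | _        = no-triangle bc cd de
    ... | no _     | no _     | no _     | no _     | yes refl = no-triangle ab bc ea
    ... | no a≢c   | no a≢d   | no b≢d   | no b≢e   | no c≢e   =
      no-short-closed-walk a (b ∷ c ∷ d ∷ e ∷ [])
      ((Adj⇒≢ ab ∷ a≢c ∷ a≢d ∷ Adj⇒≢ (Adj-sym ea) ∷ []) ∷
       (Adj⇒≢ bc ∷ b≢d ∷ b≢e ∷ []) ∷ (Adj⇒≢ cd ∷ c≢e ∷ []) ∷ (Adj⇒≢ de ∷ []) ∷ [] ∷ [])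
      (ab ∷ bc ∷ cd ∷ de ∷ [-]) ea

    no-closed-walk₆ : ∀ {a b c d e f} →
                      Adj a b → Adj b c → Adj c d → Adj d e → Adj e f → Adj f a →
                      a ≢ c → b ≢ d → c ≢ e → d ≢ f → e ≢ a → f ≢ b → ⊥
    no-closed-walk₆ {a} {b} {c} {d} {e} {f} ab bc cd de ef fa a≢c b≢d c≢e d≢f e≢a f≢b
      with a ≟ᶠ d | b ≟ᶠ e | c ≟ᶠ f
    ... | yes refl | _        | _        = no-triangle ab bc cd
    ... | no _     | yes refl | _        = no-triangle bc cd de
    ... | no _     | no _     | yes refl = no-triangle cd de ef
    ... | no a≢d   | no b≢e   | no c≢f   =
      no-short-closed-walk a (b ∷ c ∷ d ∷ e ∷ f ∷ [])
      ((Adj⇒≢ ab ∷ a≢c ∷ a≢d ∷ e≢a ∘ sym ∷ Adj⇒≢ (Adj-sym fa) ∷ []) ∷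
       (Adj⇒≢ bc ∷ b≢d ∷ b≢e ∷ f≢b ∘ sym ∷ []) ∷
       (Adj⇒≢ cd ∷ c≢e ∷ c≢f ∷ []) ∷ (Adj⇒≢ de ∷ d≢f ∷ []) ∷ (Adj⇒≢ ef ∷ []) ∷ [] ∷ [])
      (ab ∷ bc ∷ cd ∷ de ∷ ef ∷ [-]) fa

  module ExtendColouring {c K : ℕ} (c+c≤K : c + c ≤ K)
    (φ : Vertex G → Fin c) (φ-proper : ∀ {x y} → Adj x y → φ x ≢ φ y)
    (τ : Vertex G → Maybe (Fin K))
    (τ-proper : ∀ {x y a b} → Adj x y → τ x ≡ just a → τ y ≡ just b → a ≢ b)
    (τ-sparse : ∀ {x y y′ b b′} → τ x ≡ nothing → Adj x y → Adj x y′ →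
                τ y ≡ just b → τ y′ ≡ just b′ → y ≡ y′)
    where

    embed : Fin c ⊎ Fin c → Fin K
    embed s = inject≤ (join c c s) c+c≤K

    embed-injective : Injective _≡_ _≡_ embed
    embed-injective {s} {t} eq = begin
      s                      ≡⟨ sym (splitAt-join c c s) ⟩
      splitAt c (join c c s) ≡⟨ cong (splitAt c) (inject≤-injective _ _ _ _ eq) ⟩
      splitAt c (join c c t) ≡⟨ splitAt-join c c t ⟩
      t                      ∎
      where open ≡-Reasoning

    tag : Bool → Fin c → Fin c ⊎ Fin c
    tag false = inj₁
    tag true  = inj₂

    tag-injective : ∀ b b′ {i j} → tag b i ≡ tag b′ j → i ≡ j
    tag-injective false false refl = refl
    tag-injective true  true  refl = refl
    tag-injective false true  ()
    tag-injective true  false ()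

    Blocked : Vertex G → Set
    Blocked x = ∃ λ y → Adj x y × τ y ≡ just (embed (inj₁ (φ x)))

    blocked? : ∀ x → Dec (Blocked x)
    blocked? x = any? λ y → adj? x y ×-dec ≡-decᵐ _≟ᶠ_ (τ y) (just (embed (inj₁ (φ x))))

    uncoloured : Vertex G → Fin K
    uncoloured x = embed (tag (does (blocked? x)) (φ x))

    ψ : Vertex G → Fin K
    ψ x = fromMaybe (uncoloured x) (τ x)

    ψ-extends : ∀ x {a} → τ x ≡ just a → ψ x ≡ a
    ψ-extends _ = cong (fromMaybe _)

    uncoloured-proper : ∀ {x y} → Adj x y → uncoloured x ≢ uncoloured y
    uncoloured-proper {x} {y} x~y eq =
      φ-proper x~y (tag-injective (does (blocked? x)) (does (blocked? y)) (embed-injective eq))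

    uncoloured-avoids : ∀ {x y b} → τ x ≡ nothing → Adj x y → τ y ≡ just b →
                        uncoloured x ≢ b
    uncoloured-avoids {x} {y} τx x~y τy with blocked? x
    ... | no ¬blocked = λ low≡b → ¬blocked (y , x~y , trans τy (cong just (sym low≡b)))
    ... | yes (y₀ , x~y₀ , τy₀) with τ-sparse τx x~y₀ x~y τy₀ τy
    ...   | refl = λ high≡b →
      inj₂≢inj₁ (embed-injective (trans high≡b (just-injective (trans (sym τy) τy₀))))
      where
      inj₂≢inj₁ : ∀ {i j : Fin c} → inj₂ i ≢ inj₁ j
      inj₂≢inj₁ ()

    ψ-proper : ∀ {x y} → Adj x y → ψ x ≢ ψ y
    ψ-proper {x} {y} x~y with τ x in τx | τ y in τy
    ... | just a  | just b  = τ-proper x~y τx τy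
    ... | nothing | just b  = uncoloured-avoids τx x~y τy
    ... | just a  | nothing = uncoloured-avoids τy (Adj-sym x~y) τx ∘ sym
    ... | nothing | nothing = uncoloured-proper x~y

  record IrisTree (u : Vertex G) (p : ℕ) : Set where
    field
      v           : Fin (suc p) → Vertex G
      v-injective : Injective _≡_ _≡_ v
      u~v         : ∀ i → Adj u (v i)
      w           : Fin (suc p) → Fin p → Vertex G
      w-injective : ∀ i → Injective _≡_ _≡_ (w i)
      v~w         : ∀ i a → Adj (v i) (w i a)
      w≢u         : ∀ i a → w i a ≢ u

  neighbours-avoiding : ∀ {p} y → suc p ≤ deg G y → (u : Vertex G) →
                        Σ (Fin p → Vertex G) λ f →
                          Injective _≡_ _≡_ f × (∀ a → Adj y (f a)) × (∀ a → f a ≢ u)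
  neighbours-avoiding y p+1≤deg u
    with choose (filter⁺ (adj? y) (allFin⁺ n)) (all-filter (adj? y) (allFin n)) p+1≤deg
  ... | f , f-injective , y~f with punchIn-avoiding _≟ᶠ_ f f-injective u
  ...   | q , f≢u = f ∘ punchIn q , punchIn-injective q _ _ ∘ f-injective , y~f ∘ punchIn q , f≢u

  irisTree : ∀ {p u} → IsIris G (suc (suc p)) u → IrisTree u p
  irisTree {p} {u} (S , S-unique , u~S , p+1≤|S| , deg-S)
    with choose S-unique (All.zip (u~S , deg-S)) p+1≤|S|
  ... | v , v-injective , v-in-S = record
    { v = v ; v-injective = v-injective ; u~v = proj₁ ∘ v-in-S
    ; w = proj₁ ∘ below ; w-injective = proj₁ ∘ proj₂ ∘ below
    ; v~w = proj₁ ∘ proj₂ ∘ proj₂ ∘ below ; w≢u = proj₂ ∘ proj₂ ∘ proj₂ ∘ below }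
    where
    below : ∀ i → Σ (Fin p → Vertex G) λ f →
                    Injective _≡_ _≡_ f × (∀ a → Adj (v i) (f a)) × (∀ a → f a ≢ u)
    below i = neighbours-avoiding (v i) (proj₂ (v-in-S i)) u

  module TreeColouring (girth : GirthAtLeast G 7) {u p} (T : IrisTree u p) where
    open IrisTree T
    open Girth≥7 girth

    data InTree (x : Vertex G) : Set where
      root       : x ≡ u → InTree x
      child      : ∀ i → v i ≡ x → InTree x
      grandchild : ∀ i a → w i a ≡ x → InTree x

    -- punchIn i a ranges over Fin (suc p) without i.
    label : ∀ {x} → InTree x → Fin (suc (suc p))
    label (root _)           = zero
    label (child i _)        = suc i
    label (grandchild i a _) = suc (punchIn i a)

    v≢u : ∀ i → v i ≢ u
    v≢u i = Adj⇒≢ (Adj-sym (u~v i))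

    w≢v : ∀ i a j → w i a ≢ v j
    w≢v i a j w≡v with i ≟ᶠ j
    ... | yes refl = Adj⇒≢ (v~w i a) (sym w≡v)
    ... | no _     = no-triangle (u~v i) (subst (Adj (v i)) w≡v (v~w i a)) (Adj-sym (u~v j))

    v≁other-w : ∀ i j b → i ≢ j → ¬ Adj (v i) (w j b)
    v≁other-w i j b i≢j vi~w = no-closed-walk₄ (u~v i) vi~w (Adj-sym (v~w j b)) (Adj-sym (u~v j))
                                  (w≢u j b ∘ sym) (i≢j ∘ v-injective)

    w-branch-injective : ∀ {i a j b} → w i a ≡ w j b → i ≡ j
    w-branch-injective {i} {a} {j} {b} w≡w with i ≟ᶠ j
    ... | yes i≡j = i≡j
    ... | no  i≢j = ⊥-elim (v≁other-w i j b i≢j (subst (Adj (v i)) w≡w (v~w i a)))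

    label-unique : ∀ {x} (s t : InTree x) → label s ≡ label t
    label-unique (root _)              (root _)             = refl
    label-unique (root refl)           (child i vi≡u)       = ⊥-elim (v≢u i vi≡u)
    label-unique (root refl)           (grandchild i a w≡u) = ⊥-elim (w≢u i a w≡u)
    label-unique (child i refl)        (root vi≡u)          = ⊥-elim (v≢u i vi≡u)
    label-unique (child i refl)        (child j vj≡vi)      = cong suc (v-injective (sym vj≡vi))
    label-unique (child i refl)        (grandchild j a w≡v) = ⊥-elim (w≢v j a i w≡v)
    label-unique (grandchild i a refl) (root w≡u)           = ⊥-elim (w≢u i a w≡u)
    label-unique (grandchild i a refl) (child j v≡w)        = ⊥-elim (w≢v i a j (sym v≡w))
    label-unique (grandchild i a refl) (grandchild j b w≡w) with w-branch-injective w≡w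
    ... | refl = cong (suc ∘ punchIn i) (w-injective i (sym w≡w))

    child-grandchild-labels : ∀ i j a → Adj (v i) (w j a) → suc i ≢ suc (punchIn j a)
    child-grandchild-labels i j a vi~w with i ≟ᶠ j
    ... | yes refl = punchInᵢ≢i i a ∘ sym ∘ suc-injective
    ... | no  i≢j  = ⊥-elim (v≁other-w i j a i≢j vi~w)

    label-proper : ∀ {x y} → Adj x y → (s : InTree x) (t : InTree y) → label s ≢ label t
    label-proper x~y (root refl)          (root refl)          = ⊥-elim (irref x~y)
    label-proper _   (root _)             (child _ _)          = λ ()
    label-proper x~y (root refl)          (grandchild i a refl) =
      ⊥-elim (no-triangle x~y (Adj-sym (v~w i a)) (Adj-sym (u~v i)))
    label-proper _   (child _ _)          (root _)             = λ ()
    label-proper x~y (child i refl)       (child j refl) with i ≟ᶠ j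
    ... | yes refl = ⊥-elim (irref x~y)
    ... | no  _    = ⊥-elim (no-triangle (u~v i) x~y (Adj-sym (u~v j)))
    label-proper x~y (child i refl)       (grandchild j a refl) = child-grandchild-labels i j a x~y
    label-proper _   (grandchild _ _ _)   (root _)             = λ ()
    label-proper x~y (grandchild i a refl) (child j refl)      =
      child-grandchild-labels j i a (Adj-sym x~y) ∘ sym
    label-proper x~y (grandchild i a refl) (grandchild j b refl) with i ≟ᶠ j
    ... | yes refl = ⊥-elim (no-triangle (v~w i a) x~y (Adj-sym (v~w i b)))
    ... | no  _    = ⊥-elim (no-closed-walk₅ (u~v i) (v~w i a) x~y (Adj-sym (v~w j b)) (Adj-sym (u~v j)))

    module _ {x} (x∉T : ¬ InTree x) where

      x≢u : x ≢ u
      x≢u = x∉T ∘ root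

      v≢x : ∀ i → v i ≢ x
      v≢x i = x∉T ∘ child i

      root-child : ∀ i → Adj x u → ¬ Adj x (v i)
      root-child i x~u x~v = no-triangle x~u (u~v i) (Adj-sym x~v)

      root-grandchild : ∀ i a → Adj x u → ¬ Adj x (w i a)
      root-grandchild i a x~u x~w =
        no-closed-walk₄ x~u (u~v i) (v~w i a) (Adj-sym x~w) (v≢x i ∘ sym) (w≢u i a ∘ sym)

      child-grandchild : ∀ i j a → Adj x (v i) → ¬ Adj x (w j a)
      child-grandchild i j a x~v x~w with i ≟ᶠ j
      ... | yes refl = no-triangle x~v (v~w i a) (Adj-sym x~w)
      ... | no  _    = no-closed-walk₅ x~v (Adj-sym (u~v i)) (u~v j) (v~w j a) (Adj-sym x~w)

      child-child : ∀ i j → Adj x (v i) → Adj x (v j) → i ≡ j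
      child-child i j x~vi x~vj with i ≟ᶠ j
      ... | yes i≡j = i≡j
      ... | no  i≢j = ⊥-elim (no-closed-walk₄ x~vi (Adj-sym (u~v i)) (u~v j) (Adj-sym x~vj)
                                              x≢u (i≢j ∘ v-injective))

      grandchild-grandchild : ∀ i a j b → Adj x (w i a) → Adj x (w j b) → w i a ≡ w j b
      grandchild-grandchild i a j b x~wia x~wjb with i ≟ᶠ j | a ≟ᶠ b
      ... | yes refl | yes refl = refl
      ... | yes refl | no a≢b = ⊥-elim (no-closed-walk₄ x~wia (Adj-sym (v~w i a)) (v~w i b) (Adj-sym x~wjb)
                                                        (v≢x i ∘ sym) (a≢b ∘ w-injective i))
      ... | no  i≢j  | _      = ⊥-elim (no-closed-walk₆
        x~wia (Adj-sym (v~w i a)) (Adj-sym (u~v i)) (u~v j) (v~w j b) (Adj-sym x~wjb)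
        (v≢x i ∘ sym) (w≢u i a) (i≢j ∘ v-injective) (w≢u j b ∘ sym) (v≢x j) (i≢j ∘ sym ∘ w-branch-injective))

      tree-neighbour-unique : ∀ {y y′} → Adj x y → Adj x y′ → InTree y → InTree y′ → y ≡ y′
      tree-neighbour-unique _ _  (root refl)           (root refl)           = refl
      tree-neighbour-unique h h′ (root refl)           (child i refl)        = ⊥-elim (root-child i h h′)
      tree-neighbour-unique h h′ (root refl)           (grandchild i a refl) = ⊥-elim (root-grandchild i a h h′)
      tree-neighbour-unique h h′ (child i refl)        (root refl)           = ⊥-elim (root-child i h′ h)
      tree-neighbour-unique h h′ (child i refl)        (child j refl)        = cong v (child-child i j h h′)
      tree-neighbour-unique h h′ (child i refl)        (grandchild j a refl) = ⊥-elim (child-grandchild i j a h h′)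
      tree-neighbour-unique h h′ (grandchild i a refl) (root refl)           = ⊥-elim (root-grandchild i a h′ h)
      tree-neighbour-unique h h′ (grandchild i a refl) (child j refl)        = ⊥-elim (child-grandchild j i a h′ h)
      tree-neighbour-unique h h′ (grandchild i a refl) (grandchild j b refl) = grandchild-grandchild i a j b h h′

    inTree? : ∀ x → Dec (InTree x)
    inTree? x with x ≟ᶠ u
    ... | yes x≡u = yes (root x≡u)
    ... | no  x≢u with any? (λ i → v i ≟ᶠ x)
    ...   | yes (i , v≡x) = yes (child i v≡x)
    ...   | no  ∄i with any? (λ i → any? (λ a → w i a ≟ᶠ x))
    ...     | yes (i , a , w≡x) = yes (grandchild i a w≡x)
    ...     | no  ∄ia = no λ { (root x≡u) → x≢u x≡u
                             ; (child i v≡x) → ∄i (i , v≡x)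
                             ; (grandchild i a w≡x) → ∄ia (i , a , w≡x) }

    τ : Vertex G → Maybe (Fin (suc (suc p)))
    τ x = Maybe.map label (dec⇒maybe (inTree? x))

    τ-inTree : ∀ {x} (s : InTree x) → τ x ≡ just (label s)
    τ-inTree {x} s with inTree? x
    ... | yes s′ = cong just (label-unique s′ s)
    ... | no  x∉T = ⊥-elim (x∉T s)

    τ-just : ∀ {x a} → τ x ≡ just a → Σ (InTree x) λ s → label s ≡ a
    τ-just {x} τx with inTree? x
    τ-just refl | yes s = s , refl
    τ-just ()   | no  _

    τ-nothing : ∀ {x} → τ x ≡ nothing → ¬ InTree x
    τ-nothing τx s with () ← trans (sym τx) (τ-inTree s)

    τ-proper : ∀ {x y a b} → Adj x y → τ x ≡ just a → τ y ≡ just b → a ≢ b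
    τ-proper x~y τx τy with τ-just τx | τ-just τy
    ... | s , s↦a | t , t↦b = λ a≡b → label-proper x~y s t (trans s↦a (trans a≡b (sym t↦b)))

    τ-sparse : ∀ {x y y′ b b′} → τ x ≡ nothing → Adj x y → Adj x y′ →
               τ y ≡ just b → τ y′ ≡ just b′ → y ≡ y′
    τ-sparse τx x~y x~y′ τy τy′ =
      tree-neighbour-unique (τ-nothing τx) x~y x~y′ (proj₁ (τ-just τy)) (proj₁ (τ-just τy′))

  irisTree-bColouring : GirthAtLeast G 7 → ∀ {c u p} (φ : Vertex G → Fin c) →
                        (∀ {x y} → Adj x y → φ x ≢ φ y) → c + c ≤ suc (suc p) →
                        IrisTree u p → HasBColoring G (suc (suc p))
  irisTree-bColouring girth {u = u} {p} φ φ-proper c+c≤K T = colouring , b-colouring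
    where
    open IrisTree T
    open TreeColouring girth T
    open ExtendColouring c+c≤K φ φ-proper τ τ-proper τ-sparse

    ψu : ψ u ≡ zero
    ψu = ψ-extends u (τ-inTree (root refl))

    ψv : ∀ i → ψ (v i) ≡ suc i
    ψv i = ψ-extends (v i) (τ-inTree (child i refl))

    ψw : ∀ i a → ψ (w i a) ≡ suc (punchIn i a)
    ψw i a = ψ-extends (w i a) (τ-inTree (grandchild i a refl))

    colouring : Coloring G (suc (suc p))
    colouring = record { ψ = ψ ; proper = ψ-proper ; onto = strictlySurjective⇒surjective onto }
      where
      onto : ∀ colour → ∃ λ x → ψ x ≡ colour
      onto zero    = u , ψu
      onto (suc i) = v i , ψv i

    u-is-b-vertex : IsBVertex G colouring u
    u-is-b-vertex zero    0≢ψu = ⊥-elim (0≢ψu (sym ψu))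
    u-is-b-vertex (suc i) _    = v i , u~v i , ψv i

    v-is-b-vertex : ∀ i → IsBVertex G colouring (v i)
    v-is-b-vertex i zero    _     = u , Adj-sym (u~v i) , ψu
    v-is-b-vertex i (suc j) j≢ψvi =
      w i (punchOut i≢j) , v~w i _ , trans (ψw i _) (cong suc (punchIn-punchOut i≢j))
      where
      i≢j : i ≢ j
      i≢j refl = j≢ψvi (sym (ψv i))

    b-colouring : IsBColoring G colouring
    b-colouring zero    = u , ψu , u-is-b-vertex
    b-colouring (suc i) = v i , ψv i , v-is-b-vertex i

lemma3 : (G : Graph) → GirthAtLeast G 7 → (k c : ℕ) → IsChromaticNumber G c →
         2 * c ≤ k → HasIris G k → HasBColoring G k
lemma3 G girth k c (χ-colouring , _) 2c≤k (u , iris) = go k 2≤k 2c≤k iris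
  where
  φ : Vertex G → Fin c
  φ = Coloring.ψ χ-colouring

  1≤c : 1 ≤ c
  1≤c = ℕ.≤-trans (s≤s z≤n) (toℕ<n (φ u))

  2≤k : 2 ≤ k
  2≤k = ℕ.≤-trans (ℕ.*-monoʳ-≤ 2 1≤c) 2c≤k

  go : ∀ k → 2 ≤ k → 2 * c ≤ k → IsIris G k u → HasBColoring G k
  go (suc (suc p)) _ 2c≤k iris = irisTree-bColouring G girth φ (Coloring.proper χ-colouring)
    (subst (λ m → c + m ≤ suc (suc p)) (ℕ.+-identityʳ c) 2c≤k) (irisTree G iris)
  go (suc zero) (s≤s ())
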